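{- For $n\ge1$ and any topological space $X$, the following are equivalent: $X\models_d\mathbb{C}_n$; $X\models_d\mathbb{C}_n^*$; $X\models_C\mathbb{C}_n$; $X$ is hereditarily $(n+1)$-irresolvable.
   Context: Modal formulas are built from variables by $\top,\neg,\wedge,\Box$, with $\Diamond=\neg\Box\neg$, $\Box^*\varphi=\varphi\wedge\Box\varphi$, $\Diamond^*\varphi=\varphi\vee\Diamond\varphi$. A topological model on $X$ assigns subsets of $X$ to variables; Boolean connectives are set operations. In C-semantics $\Diamond$ is interpreted as topological closure (and $\Box$ as interior); in d-semantics $\Diamond$ is interpreted as the derived set operator (set of limit points: $x$ is in the derived set of $Y$ iff every open neighbourhood of $x$ meets $Y\setminus\{x\}$), and $\Box=\neg\Diamond\neg$. $X\models_C\Sigma$ (resp. $X\models_d\Sigma$) means every instance of the scheme $\Sigma$ has truth set $X$ in every model on $X$ under C- (resp. d-) semantics. Define $\mathbb{P}_0(\varphi_0)=\Diamond\varphi_0$, $\mathbb{P}_n(\varphi_0,\dots,\varphi_n)=\Diamond(\varphi_1\wedge\mathbb{P}_{n-1}(\varphi_0,\varphi_2,\dots,\varphi_n))$ for $n>0$; $\mathbb{D}_n=\bigwedge_{i<j\le n}\neg(\varphi_i\wedge\varphi_j)$; $\mathbb{C}_n$ is the scheme $\Box^*\mathbb{D}_n\to(\Diamond\varphi_0\to\Diamond(\varphi_0\wedge\neg\mathbb{P}_n))$ and $\mathbb{C}_n^*$ is the scheme $\Box^*\mathbb{D}_n\to(\Diamond\varphi_0\to\Diamond^*(\varphi_0\wedge\neg\mathbb{P}_n))$.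 For $k\ge2$, a space is $k$-resolvable if it has $k$ pairwise disjoint dense subsets, $k$-irresolvable otherwise, and hereditarily $k$-irresolvable if every non-empty subspace is $k$-irresolvable. -}

module Defs where

open import Level using (0ℓ)
open import Data.Nat using (ℕ; zero; suc)
open import Data.Fin using (Fin)
open import Data.Product using (Σ; ∃; _×_; _,_)
open import Data.Sum using (_⊎_)
open import Data.Unit using (⊤)
open import Data.Empty using (⊥)
open import Relation.Nullary using (¬_)
open import Relation.Binary.PropositionalEquality using (_≡_; _≢_)

-- The topology is
-- presented by a (small) type of codes for open sets together with their
-- extensions; the codes are closed under finite intersections (including
-- the whole space) and arbitrary (Set-indexed) unions.  The open sets of
-- the space are exactly the extensions of codes.

Subset : Set → Set₁
Subset X = X → Set

record TopSpace : Set₁ where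
  field
    Carrier : Set
    Code    : Set
    ⟦_⟧     : Code → Subset Carrier
    whole   : Σ Code λ c → ∀ x → ⟦ c ⟧ x
    inter   : ∀ (c d : Code) → Σ Code λ e →
                ∀ x → (⟦ e ⟧ x → ⟦ c ⟧ x × ⟦ d ⟧ x) × (⟦ c ⟧ x × ⟦ d ⟧ x → ⟦ e ⟧ x)
    union   : ∀ {I : Set} (f : I → Code) → Σ Code λ e →
                ∀ x → (⟦ e ⟧ x → Σ I λ i → ⟦ f i ⟧ x) × (Σ I (λ i → ⟦ f i ⟧ x) → ⟦ e ⟧ x)

module _ (X : TopSpace) where
  open TopSpace X

  closure : Subset Carrier → Subset Carrier
  closure Y x = ∀ (c : Code) → ⟦ c ⟧ x → Σ Carrier λ y → ⟦ c ⟧ y × Y y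

  interior : Subset Carrier → Subset Carrier
  interior Y x = Σ Code λ c → ⟦ c ⟧ x × (∀ y → ⟦ c ⟧ y → Y y)

  derived : Subset Carrier → Subset Carrier
  derived Y x = ∀ (c : Code) → ⟦ c ⟧ x → Σ Carrier λ y → ⟦ c ⟧ y × y ≢ x × Y y

data Form : Set where
  var  : ℕ → Form
  ⊤'   : Form
  ¬'_  : Form → Form
  _∧'_ : Form → Form → Form
  □_   : Form → Form

infixr 6 _∧'_
infixr 5 _∨'_
infixr 4 _⇒'_

◇_ : Form → Form
◇ φ = ¬' (□ (¬' φ))

_∨'_ : Form → Form → Form
φ ∨' ψ = ¬' ((¬' φ) ∧' (¬' ψ))

_⇒'_ : Form → Form → Form
φ ⇒' ψ = ¬' (φ ∧' (¬' ψ))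

□*_ : Form → Form
□* φ = φ ∧' (□ φ)

◇*_ : Form → Form
◇* φ = φ ∨' (◇ φ)

subst : (ℕ → Form) → Form → Form
subst σ (var i)  = σ i
subst σ ⊤'       = ⊤'
subst σ (¬' φ)   = ¬' subst σ φ
subst σ (φ ∧' ψ) = subst σ φ ∧' subst σ ψ
subst σ (□ φ)    = □ subst σ φ

-- The schemes.  Scheme metavariables φ_i are the variables  var i.

open import Data.List using (List; []; _∷_; applyUpTo)

ℙ' : Form → List Form → Form
ℙ' φ0 []         = ◇ φ0
ℙ' φ0 (φ1 ∷ φs)  = ◇ (φ1 ∧' ℙ' φ0 φs)

ℙ : ℕ → Form
ℙ n = ℙ' (var 0) (applyUpTo (λ i → var (suc i)) n)

below : ℕ → ℕ → Form
below j zero    = ⊤'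
below j (suc i) = below j i ∧' ¬' (var i ∧' var j)

-- 𝔻_n = ⋀_{i<j≤n} ¬(φ_i ∧ φ_j)
𝔻 : ℕ → Form
𝔻 zero    = ⊤'
𝔻 (suc n) = 𝔻 n ∧' below (suc n) (suc n)

ℂ : ℕ → Form
ℂ n = □* 𝔻 n ⇒' (◇ var 0 ⇒' ◇ (var 0 ∧' ¬' ℙ n))

ℂ* : ℕ → Form
ℂ* n = □* 𝔻 n ⇒' (◇ var 0 ⇒' ◇* (var 0 ∧' ¬' ℙ n))

module _ (X : TopSpace) where
  open TopSpace X

  Valuation : Set₁
  Valuation = ℕ → Subset Carrier

  ⟦_⟧C : Form → Valuation → Subset Carrier
  ⟦ var i ⟧C  V x = V i x
  ⟦ ⊤' ⟧C     V x = ⊤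
  ⟦ ¬' φ ⟧C   V x = ¬ ⟦ φ ⟧C V x
  ⟦ φ ∧' ψ ⟧C V x = ⟦ φ ⟧C V x × ⟦ ψ ⟧C V x
  ⟦ □ φ ⟧C    V x = interior X (⟦ φ ⟧C V) x

  ⟦_⟧d : Form → Valuation → Subset Carrier
  ⟦ var i ⟧d  V x = V i x
  ⟦ ⊤' ⟧d     V x = ⊤
  ⟦ ¬' φ ⟧d   V x = ¬ ⟦ φ ⟧d V x
  ⟦ φ ∧' ψ ⟧d V x = ⟦ φ ⟧d V x × ⟦ ψ ⟧d V x
  ⟦ □ φ ⟧d    V x = ¬ derived X (λ y → ¬ ⟦ φ ⟧d V y) x

  _⊨C_ : Form → Set₁
  _⊨C_ Σ' = ∀ (σ : ℕ → Form) (V : Valuation) (x : Carrier) → ⟦ subst σ Σ' ⟧C V x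

  _⊨d_ : Form → Set₁
  _⊨d_ Σ' = ∀ (σ : ℕ → Form) (V : Valuation) (x : Carrier) → ⟦ subst σ Σ' ⟧d V x

  -- Resolvability (of the subspace Y ⊆ X, with the subspace topology:
  -- its open sets are U ∩ Y for U open in X).

  DenseIn : Subset Carrier → Subset Carrier → Set
  DenseIn Y D = (∀ x → D x → Y x) ×
                (∀ (c : Code) (x : Carrier) → Y x → ⟦ c ⟧ x →
                   Σ Carrier λ y → ⟦ c ⟧ y × D y)

  Resolvable : ℕ → Subset Carrier → Set₁
  Resolvable k Y = Σ (Fin k → Subset Carrier) λ D →
    (∀ a b → a ≢ b → ∀ x → D a x → D b x → ⊥) × (∀ a → DenseIn Y (D a))

  Irresolvable : ℕ → Subset Carrier → Set₁
  Irresolvable k Y = ¬ Resolvable k Y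

  HereditarilyIrresolvable : ℕ → Set₁
  HereditarilyIrresolvable k =
    ∀ (Y : Subset Carrier) → (Σ Carrier Y) → Irresolvable k Y

-- If X is hereditarily (n+1)-irresolvable and ℂ_n fails at x, take an open
-- neighbourhood W of x on which 𝔻_n holds and on which every φ₀-point (other
-- than x, in the d-case) satisfies ℙ_n.  Unfolding ℙ_n shows that the sets
-- Z_k = φ_k ∩ W ∩ ℙ'(φ₀, φ_{k+1}, …, φ_n) form a cycle Z_0 ⊆ cl Z_1 ⊆ … ⊆ cl Z_n ⊆ cl Z_0,
-- so they are n+1 disjoint dense subsets of their non-empty union.
-- Conversely, n+1 disjoint dense subsets D_0, …, D_n of a subspace Y, read as a
-- valuation, make ℙ_n true at every φ₀-point, which refutes ℂ_n (and ℂ*_n).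
module Submission where

open import Defs
open import Level using (Level)
open import Data.Nat using (ℕ; suc; _≥_)
open import Data.Product using (_×_)
open import Function.Bundles using (_⇔_)
open import Axiom.ExcludedMiddle using (ExcludedMiddle)

open import Axiom.DoubleNegationElimination using (em⇒dne)
open import Data.Empty using (⊥)
open import Data.Fin using (Fin; toℕ; fromℕ<) renaming (zero to fzero)
open import Data.Fin.Properties using (toℕ<n; toℕ-fromℕ<; toℕ-injective)
open import Data.List using ([]; _∷_; applyUpTo; drop)
open import Data.Nat using (zero; _<_; _≤_; z≤n; s≤s; s≤s⁻¹)
open import Data.Nat.Properties using (<-cmp; <⇒≤; <⇒≢; ≤-refl; m<n⇒m<1+n; m≤n⇒m<n∨m≡n)
open import Data.Product using (Σ; _,_; proj₁; proj₂)
open import Data.Sum using (inj₁; inj₂)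
open import Data.Unit using (tt)
open import Function.Base using (_∘_)
open import Function.Bundles using (mk⇔; module Equivalence)
open import Relation.Binary.Definitions using (tri<; tri≈; tri>)
open import Relation.Binary.PropositionalEquality using (_≡_; _≢_; refl; sym; cong; cong₂) renaming (subst to ≡-subst)
open import Relation.Nullary using (¬_; yes; no)
open import Relation.Unary using (_⊆_; _∩_; ⋃; Satisfiable)

drop-applyUpTo : ∀ {A : Set} (f : ℕ → A) {n k} → k < n →
                 drop k (applyUpTo f n) ≡ f k ∷ drop (suc k) (applyUpTo f n)
drop-applyUpTo f {suc n} {zero}  _         = refl
drop-applyUpTo f {suc n} {suc k} (s≤s k<n) = drop-applyUpTo (f ∘ suc) k<n

drop-applyUpTo-all : ∀ {A : Set} (f : ℕ → A) n → drop n (applyUpTo f n) ≡ []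
drop-applyUpTo-all f zero    = refl
drop-applyUpTo-all f (suc n) = drop-applyUpTo-all (f ∘ suc) n

-- ℙ-from n k = ℙ'(φ₀; φ_{k+1}, …, φ_n), so that ℙ-from n 0 is ℙ n.
ℙ-from : ℕ → ℕ → Form
ℙ-from n k = ℙ' (var 0) (drop k (applyUpTo (λ i → var (suc i)) n))

ℙ-from-step : ∀ {n k} → k < n → ℙ-from n k ≡ ◇ (var (suc k) ∧' ℙ-from n (suc k))
ℙ-from-step k<n = cong (ℙ' (var 0)) (drop-applyUpTo (λ i → var (suc i)) k<n)

ℙ-from-end : ∀ n → ℙ-from n n ≡ ◇ var 0
ℙ-from-end n = cong (ℙ' (var 0)) (drop-applyUpTo-all (λ i → var (suc i)) n)

downward-induction : ∀ {ℓ} (P : ℕ → Set ℓ) {n} → P n → (∀ {k} → k < n → P (suc k) → P k) → P 0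
downward-induction P {zero}  P0  step = P0
downward-induction P {suc n} Psn step = downward-induction P (step ≤-refl Psn) (step ∘ m<n⇒m<1+n)

DisjointUpTo : {A : Set} → ℕ → (ℕ → A → Set) → A → Set
DisjointUpTo n Z y = ∀ {i j} → i ≢ j → i ≤ n → j ≤ n → Z i y → Z j y → ⊥

disjointUpTo-ordered : ∀ {A : Set} {n} {Z : ℕ → A → Set} {y} →
  (∀ {i j} → i < j → j ≤ n → Z i y → Z j y → ⊥) → DisjointUpTo n Z y
disjointUpTo-ordered disj {i} {j} i≢j i≤n j≤n zi zj with <-cmp i j
... | tri< i<j _ _ = disj i<j j≤n zi zj
... | tri≈ _ i≡j _ = i≢j i≡j
... | tri> _ _ j<i = disj j<i i≤n zj zi

module Space (X : TopSpace) where
  open TopSpace X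

  ⟦_⟧ᶜ ⟦_⟧ᵈ : Form → Valuation X → Subset Carrier
  ⟦_⟧ᶜ = ⟦_⟧C X
  ⟦_⟧ᵈ = ⟦_⟧d X

  ⟦subst⟧ᶜ : ∀ σ V φ → ⟦ subst σ φ ⟧ᶜ V ≡ ⟦ φ ⟧ᶜ (λ i → ⟦ σ i ⟧ᶜ V)
  ⟦subst⟧ᶜ σ V (var i)  = refl
  ⟦subst⟧ᶜ σ V ⊤'       = refl
  ⟦subst⟧ᶜ σ V (¬' φ)   = cong (λ P x → ¬ P x) (⟦subst⟧ᶜ σ V φ)
  ⟦subst⟧ᶜ σ V (φ ∧' ψ) = cong₂ _∩_ (⟦subst⟧ᶜ σ V φ) (⟦subst⟧ᶜ σ V ψ)
  ⟦subst⟧ᶜ σ V (□ φ)    = cong (interior X) (⟦subst⟧ᶜ σ V φ)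

  ⟦subst⟧ᵈ : ∀ σ V φ → ⟦ subst σ φ ⟧ᵈ V ≡ ⟦ φ ⟧ᵈ (λ i → ⟦ σ i ⟧ᵈ V)
  ⟦subst⟧ᵈ σ V (var i)  = refl
  ⟦subst⟧ᵈ σ V ⊤'       = refl
  ⟦subst⟧ᵈ σ V (¬' φ)   = cong (λ P x → ¬ P x) (⟦subst⟧ᵈ σ V φ)
  ⟦subst⟧ᵈ σ V (φ ∧' ψ) = cong₂ _∩_ (⟦subst⟧ᵈ σ V φ) (⟦subst⟧ᵈ σ V ψ)
  ⟦subst⟧ᵈ σ V (□ φ)    = cong (λ P x → ¬ derived X (λ y → ¬ P y) x) (⟦subst⟧ᵈ σ V φ)

  ⊨C⇔valid : ∀ φ → _⊨C_ X φ ⇔ (∀ V x → ⟦ φ ⟧ᶜ V x)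
  ⊨C⇔valid φ = mk⇔
    (λ H V → ≡-subst (λ P → ∀ x → P x) (⟦subst⟧ᶜ var V φ) (H var V))
    (λ H σ V → ≡-subst (λ P → ∀ x → P x) (sym (⟦subst⟧ᶜ σ V φ)) (H _))

  ⊨d⇔valid : ∀ φ → _⊨d_ X φ ⇔ (∀ V x → ⟦ φ ⟧ᵈ V x)
  ⊨d⇔valid φ = mk⇔
    (λ H V → ≡-subst (λ P → ∀ x → P x) (⟦subst⟧ᵈ var V φ) (H var V))
    (λ H σ V → ≡-subst (λ P → ∀ x → P x) (sym (⟦subst⟧ᵈ σ V φ)) (H _))

  ⟦below⟧ᶜ≡ᵈ : ∀ V j i → ⟦ below j i ⟧ᶜ V ≡ ⟦ below j i ⟧ᵈ V
  ⟦below⟧ᶜ≡ᵈ V j zero    = refl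
  ⟦below⟧ᶜ≡ᵈ V j (suc i) = cong (λ P x → P x × ¬ (V i x × V j x)) (⟦below⟧ᶜ≡ᵈ V j i)

  ⟦𝔻⟧ᶜ≡ᵈ : ∀ V n → ⟦ 𝔻 n ⟧ᶜ V ≡ ⟦ 𝔻 n ⟧ᵈ V
  ⟦𝔻⟧ᶜ≡ᵈ V zero    = refl
  ⟦𝔻⟧ᶜ≡ᵈ V (suc n) = cong₂ _∩_ (⟦𝔻⟧ᶜ≡ᵈ V n) (⟦below⟧ᶜ≡ᵈ V (suc n) (suc n))

  ⟦𝔻⟧ᶜ-disjoint : ∀ {V y} n → ⟦ 𝔻 n ⟧ᶜ V y → DisjointUpTo n V y
  ⟦𝔻⟧ᶜ-disjoint {V} {y} n 𝔻y = disjointUpTo-ordered {Z = V} (ordered n 𝔻y)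
    where
      below-disjoint : ∀ {j} i → ⟦ below j i ⟧ᶜ V y → ∀ {k} → k < i → V k y → V j y → ⊥
      below-disjoint (suc i) (below-i , ¬both) (s≤s k≤i) vk vj with m≤n⇒m<n∨m≡n k≤i
      ... | inj₁ k<i  = below-disjoint i below-i k<i vk vj
      ... | inj₂ refl = ¬both (vk , vj)

      ordered : ∀ n → ⟦ 𝔻 n ⟧ᶜ V y → ∀ {i j} → i < j → j ≤ n → V i y → V j y → ⊥
      ordered zero    _ () z≤n _ _
      ordered (suc n) (𝔻n , below-n) i<j j≤sn vi vj with m≤n⇒m<n∨m≡n j≤sn
      ... | inj₁ j<sn = ordered n 𝔻n i<j (s≤s⁻¹ j<sn) vi vj
      ... | inj₂ refl = below-disjoint (suc n) below-n i<j vi vj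

  ⟦𝔻⟧ᶜ-intro : ∀ {V y} → (∀ {i j} → i < j → V i y → V j y → ⊥) → ∀ n → ⟦ 𝔻 n ⟧ᶜ V y
  ⟦𝔻⟧ᶜ-intro {V} {y} disj zero    = tt
  ⟦𝔻⟧ᶜ-intro {V} {y} disj (suc n) = ⟦𝔻⟧ᶜ-intro disj n , below-intro (suc n) ≤-refl
    where
      below-intro : ∀ {j} i → i ≤ j → ⟦ below j i ⟧ᶜ V y
      below-intro zero    _    = tt
      below-intro (suc i) i<j = below-intro i (<⇒≤ i<j) , λ (vi , vj) → disj i<j vi vj

  ⟦𝔻⟧ᵈ-disjoint : ∀ {V y} n → ⟦ 𝔻 n ⟧ᵈ V y → DisjointUpTo n V y
  ⟦𝔻⟧ᵈ-disjoint {V} {y} n = ⟦𝔻⟧ᶜ-disjoint n ∘ ≡-subst (λ P → P y) (sym (⟦𝔻⟧ᶜ≡ᵈ V n))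

  ⟦𝔻⟧ᵈ-intro : ∀ {V y} → (∀ {i j} → i < j → V i y → V j y → ⊥) → ∀ n → ⟦ 𝔻 n ⟧ᵈ V y
  ⟦𝔻⟧ᵈ-intro {V} {y} disj n = ≡-subst (λ P → P y) (⟦𝔻⟧ᶜ≡ᵈ V n) (⟦𝔻⟧ᶜ-intro disj n)

  univ : Code
  univ = proj₁ whole

  ∈univ : ∀ {x} → ⟦ univ ⟧ x
  ∈univ {x} = proj₂ whole x

  _∩ᶜ_ : Code → Code → Code
  c ∩ᶜ d = proj₁ (inter c d)

  ∩ᶜ⁻ : ∀ {c d} → ⟦ c ∩ᶜ d ⟧ ⊆ ⟦ c ⟧ ∩ ⟦ d ⟧
  ∩ᶜ⁻ {c} {d} {x} = proj₁ (proj₂ (inter c d) x)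

  ∩ᶜ⁺ : ∀ {c d} → ⟦ c ⟧ ∩ ⟦ d ⟧ ⊆ ⟦ c ∩ᶜ d ⟧
  ∩ᶜ⁺ {c} {d} {x} = proj₂ (proj₂ (inter c d) x)

  punctured-interior : Subset Carrier → Subset Carrier
  punctured-interior P x = Σ Code λ c → ⟦ c ⟧ x × (∀ z → ⟦ c ⟧ z → z ≢ x → P z)

  ⊆-closure : ∀ {S} → S ⊆ closure X S
  ⊆-closure {x = y} s c cy = y , cy , s

  closure-⊆-closure : ∀ {S T} → S ⊆ closure X T → closure X S ⊆ closure X T
  closure-⊆-closure S⊆T̄ S̄y c cy = let (z , cz , sz) = S̄y c cy in S⊆T̄ sz c cz

  closure-mono : ∀ {S T} → S ⊆ T → closure X S ⊆ closure X T
  closure-mono S⊆T = closure-⊆-closure (⊆-closure ∘ S⊆T)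

  closure-∩-open : ∀ {S} w → closure X S ∩ ⟦ w ⟧ ⊆ closure X (S ∩ ⟦ w ⟧)
  closure-∩-open w (S̄y , wy) c cy =
    let (z , cwz , sz) = S̄y (c ∩ᶜ w) (∩ᶜ⁺ (cy , wy)) ; (cz , wz) = ∩ᶜ⁻ cwz
    in z , cz , sz , wz

  derived-∩-open : ∀ {S} w → derived X S ∩ ⟦ w ⟧ ⊆ derived X (S ∩ ⟦ w ⟧)
  derived-∩-open w (S′y , wy) c cy =
    let (z , cwz , z≢y , sz) = S′y (c ∩ᶜ w) (∩ᶜ⁺ (cy , wy)) ; (cz , wz) = ∩ᶜ⁻ cwz
    in z , cz , z≢y , sz , wz

  derived-mono : ∀ {S T} → S ⊆ T → derived X S ⊆ derived X T
  derived-mono S⊆T S′y c cy = let (z , cz , z≢y , sz) = S′y c cy in z , cz , z≢y , S⊆T sz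

  derived⊆closure : ∀ {S} → derived X S ⊆ closure X S
  derived⊆closure S′y c cy = let (z , cz , _ , sz) = S′y c cy in z , cz , sz

  closure⇒◇ᶜ : ∀ φ V → closure X (⟦ φ ⟧ᶜ V) ⊆ ⟦ ◇ φ ⟧ᶜ V
  closure⇒◇ᶜ φ V φ̄y (c , cy , c⊆¬φ) = let (z , cz , φz) = φ̄y c cy in c⊆¬φ z cz φz

  derived⇒◇ᵈ : ∀ φ V → derived X (⟦ φ ⟧ᵈ V) ⊆ ⟦ ◇ φ ⟧ᵈ V
  derived⇒◇ᵈ φ V φ′y ¬◇ =
    ¬◇ λ c cy → let (z , cz , z≢y , φz) = φ′y c cy in z , cz , z≢y , λ ¬φz → ¬φz φz

  transportᶜ : ∀ {φ ψ} V → φ ≡ ψ → ⟦ φ ⟧ᶜ V ⊆ ⟦ ψ ⟧ᶜ V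
  transportᶜ V refl φy = φy

  transportᵈ : ∀ {φ ψ} V → φ ≡ ψ → ⟦ φ ⟧ᵈ V ⊆ ⟦ ψ ⟧ᵈ V
  transportᵈ V refl φy = φy

  closure⇒ℙ-fromᶜ-step : ∀ {n k} V → k < n →
    closure X (V (suc k) ∩ ⟦ ℙ-from n (suc k) ⟧ᶜ V) ⊆ ⟦ ℙ-from n k ⟧ᶜ V
  closure⇒ℙ-fromᶜ-step {n} {k} V k<n =
    transportᶜ V (sym (ℙ-from-step k<n)) ∘ closure⇒◇ᶜ (var (suc k) ∧' ℙ-from n (suc k)) V

  closure⇒ℙ-fromᶜ-end : ∀ {n} V → closure X (V 0) ⊆ ⟦ ℙ-from n n ⟧ᶜ V
  closure⇒ℙ-fromᶜ-end {n} V = transportᶜ V (sym (ℙ-from-end n)) ∘ closure⇒◇ᶜ (var 0) V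

  derived⇒ℙ-fromᵈ-step : ∀ {n k} V → k < n →
    derived X (V (suc k) ∩ ⟦ ℙ-from n (suc k) ⟧ᵈ V) ⊆ ⟦ ℙ-from n k ⟧ᵈ V
  derived⇒ℙ-fromᵈ-step {n} {k} V k<n =
    transportᵈ V (sym (ℙ-from-step k<n)) ∘ derived⇒◇ᵈ (var (suc k) ∧' ℙ-from n (suc k)) V

  derived⇒ℙ-fromᵈ-end : ∀ {n} V → derived X (V 0) ⊆ ⟦ ℙ-from n n ⟧ᵈ V
  derived⇒ℙ-fromᵈ-end {n} V = transportᵈ V (sym (ℙ-from-end n)) ∘ derived⇒◇ᵈ (var 0) V

  □ᶜ-intro : ∀ φ V → (∀ z → ⟦ φ ⟧ᶜ V z) → ∀ x → ⟦ □ φ ⟧ᶜ V x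
  □ᶜ-intro φ V φ-everywhere x = univ , ∈univ , λ z _ → φ-everywhere z

  □ᵈ-intro : ∀ φ V → (∀ z → ⟦ φ ⟧ᵈ V z) → ∀ x → ⟦ □ φ ⟧ᵈ V x
  □ᵈ-intro φ V φ-everywhere x ¬φ′x = let (z , _ , _ , ¬φz) = ¬φ′x univ ∈univ in ¬φz (φ-everywhere z)

  HI⇒cyclic-chain-empty : ∀ {n} → HereditarilyIrresolvable X (suc n) → (Z : ℕ → Subset Carrier) →
    (∀ y → DisjointUpTo n Z y) →
    (∀ {k} → k < n → Z k ⊆ closure X (Z (suc k))) →
    Z n ⊆ closure X (Z 0) →
    ¬ Satisfiable (Z 0)
  HI⇒cyclic-chain-empty {n} hi Z disjoint step end (x , z0x) =
    hi (⋃ (Fin (suc n)) (Z ∘ toℕ)) (x , fzero , z0x)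
       (Z ∘ toℕ , D-disjoint , λ a → (λ _ za → a , za) , λ c y (b , zby) → Z-dense (≤n b) (≤n a) zby c)
    where
      ≤n : (a : Fin (suc n)) → toℕ a ≤ n
      ≤n a = s≤s⁻¹ (toℕ<n a)

      D-disjoint : ∀ a b → a ≢ b → ∀ y → Z (toℕ a) y → Z (toℕ b) y → ⊥
      D-disjoint a b a≢b y = disjoint y (a≢b ∘ toℕ-injective) (≤n a) (≤n b)

      ascend : ∀ {i j} → i ≤ j → j ≤ n → Z i ⊆ closure X (Z j)
      ascend {j = zero}  z≤n _ = ⊆-closure
      ascend {j = suc j} i≤sj sj≤n with m≤n⇒m<n∨m≡n i≤sj
      ... | inj₁ (s≤s i≤j) = closure-⊆-closure (step sj≤n) ∘ ascend i≤j (<⇒≤ sj≤n)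
      ... | inj₂ refl      = ⊆-closure

      Z-dense : ∀ {i j} → i ≤ n → j ≤ n → Z i ⊆ closure X (Z j)
      Z-dense i≤n j≤n =
        closure-⊆-closure (ascend z≤n j≤n) ∘ closure-⊆-closure end ∘ ascend i≤n ≤-refl

  HI⇒chain-empty : ∀ {n} → HereditarilyIrresolvable X (suc n) →
    (V : Valuation X) (w : Code) (R : ℕ → Subset Carrier) →
    (∀ {y} → ⟦ w ⟧ y → DisjointUpTo n V y) →
    (∀ {k} → k < n → R k ⊆ closure X (V (suc k) ∩ R (suc k))) →
    R n ∩ ⟦ w ⟧ ⊆ closure X (V 0 ∩ ⟦ w ⟧ ∩ R 0) →
    ¬ Satisfiable (V 0 ∩ ⟦ w ⟧ ∩ R 0)
  HI⇒chain-empty hi V w R disjoint step end =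
    HI⇒cyclic-chain-empty hi (λ k → V k ∩ ⟦ w ⟧ ∩ R k)
      (λ y i≢j i≤n j≤n (vi , wy , _) (vj , _ , _) → disjoint wy i≢j i≤n j≤n vi vj)
      (λ k<n (_ , wy , rk) →
         closure-mono (λ ((vz , rz) , wz) → vz , wz , rz) (closure-∩-open w (step k<n rk , wy)))
      (λ (_ , wy , rn) → end (rn , wy))

  module Resolution {n} {Y : Subset Carrier} (D : Fin (suc n) → Subset Carrier)
                    (D-disjoint : ∀ a b → a ≢ b → ∀ x → D a x → D b x → ⊥)
                    (D-dense : ∀ a → DenseIn X Y (D a)) where

    V : Valuation X
    V i y = Σ (Fin (suc n)) λ a → toℕ a ≡ i × D a y

    V-disjoint : ∀ {y i j} → i < j → V i y → V j y → ⊥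
    V-disjoint i<j (a , refl , da) (b , refl , db) =
      D-disjoint a b (<⇒≢ i<j ∘ cong toℕ) _ da db

    V⊆Y : ∀ {k} → V k ⊆ Y
    V⊆Y (a , _ , da) = proj₁ (D-dense a) _ da

    Y⊆closure-V : ∀ {k} → k ≤ n → Y ⊆ closure X (V k)
    Y⊆closure-V k≤n yy c cy =
      let a = fromℕ< (s≤s k≤n) ; (z , cz , dz) = proj₂ (D-dense a) c _ yy cy
      in z , cz , a , toℕ-fromℕ< (s≤s k≤n) , dz

    ℙᶜ-on-Y : Y ⊆ ⟦ ℙ n ⟧ᶜ V
    ℙᶜ-on-Y = downward-induction (λ k → Y ⊆ ⟦ ℙ-from n k ⟧ᶜ V)
      (closure⇒ℙ-fromᶜ-end {n} V ∘ Y⊆closure-V z≤n)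
      (λ k<n IH → closure⇒ℙ-fromᶜ-step V k<n ∘ closure-mono (λ vz → vz , IH (V⊆Y vz))
                    ∘ Y⊆closure-V k<n)

    V-derived : ∀ {i j} → j ≤ n → (∀ {z} → V j z → V i z → ⊥) → V i ⊆ derived X (V j)
    V-derived j≤n disj vi c cy =
      let (z , cz , vj) = Y⊆closure-V j≤n (V⊆Y vi) c cy
      in z , cz , (λ z≡y → disj vj (≡-subst (V _) (sym z≡y) vi)) , vj

    -- Each ◇-witness lies in the next D, so differs from the current point; from φ_n to φ₀ this needs n ≥ 1.
    ℙᵈ-on-V₀ : 1 ≤ n → V 0 ⊆ ⟦ ℙ n ⟧ᵈ V
    ℙᵈ-on-V₀ 1≤n = downward-induction (λ k → V k ⊆ ⟦ ℙ-from n k ⟧ᵈ V)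
      (derived⇒ℙ-fromᵈ-end {n} V ∘ V-derived z≤n (V-disjoint 1≤n))
      (λ k<n IH → derived⇒ℙ-fromᵈ-step V k<n ∘ derived-mono (λ vz → vz , IH vz)
                    ∘ V-derived k<n (λ vsk vk → V-disjoint ≤-refl vk vsk))

  ℂᶜ-valid⇒HI : ∀ n → (∀ V x → ⟦ ℂ n ⟧ᶜ V x) → HereditarilyIrresolvable X (suc n)
  ℂᶜ-valid⇒HI n ℂ-valid Y (x , yx) (D , D-disjoint , D-dense) =
    ℂ-valid V x (□*𝔻 , λ ¬concl → ¬concl (◇φ₀ , ¬◇bad))
    where
      open Resolution D D-disjoint D-dense
      𝔻-everywhere : ∀ z → ⟦ 𝔻 n ⟧ᶜ V z
      𝔻-everywhere z = ⟦𝔻⟧ᶜ-intro V-disjoint n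
      □*𝔻 : ⟦ □* 𝔻 n ⟧ᶜ V x
      □*𝔻 = 𝔻-everywhere x , □ᶜ-intro (𝔻 n) V 𝔻-everywhere x
      ◇φ₀ : ⟦ ◇ var 0 ⟧ᶜ V x
      ◇φ₀ = closure⇒◇ᶜ (var 0) V (Y⊆closure-V z≤n yx)
      ¬◇bad : ¬ ⟦ ◇ (var 0 ∧' ¬' ℙ n) ⟧ᶜ V x
      ¬◇bad ◇bad =
        ◇bad (□ᶜ-intro (¬' (var 0 ∧' ¬' ℙ n)) V (λ z (v0z , ¬ℙz) → ¬ℙz (ℙᶜ-on-Y (V⊆Y v0z))) x)

  ℂ*ᵈ-valid⇒HI : ∀ n → 1 ≤ n → (∀ V x → ⟦ ℂ* n ⟧ᵈ V x) → HereditarilyIrresolvable X (suc n)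
  ℂ*ᵈ-valid⇒HI n 1≤n ℂ*-valid Y (x₀ , yx₀) (D , D-disjoint , D-dense)
    with Resolution.Y⊆closure-V D D-disjoint D-dense 1≤n yx₀ univ ∈univ
  ... | x , _ , v1x = ℂ*-valid V x (□*𝔻 , λ ¬concl → ¬concl (◇φ₀ , ¬◇*bad))
    where
      open Resolution D D-disjoint D-dense
      𝔻-everywhere : ∀ z → ⟦ 𝔻 n ⟧ᵈ V z
      𝔻-everywhere z = ⟦𝔻⟧ᵈ-intro V-disjoint n
      □*𝔻 : ⟦ □* 𝔻 n ⟧ᵈ V x
      □*𝔻 = 𝔻-everywhere x , □ᵈ-intro (𝔻 n) V 𝔻-everywhere x
      ◇φ₀ : ⟦ ◇ var 0 ⟧ᵈ V x
      ◇φ₀ = derived⇒◇ᵈ (var 0) V (V-derived z≤n (V-disjoint ≤-refl) v1x)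
      no-bad : ∀ z → ⟦ ¬' (var 0 ∧' ¬' ℙ n) ⟧ᵈ V z
      no-bad z (v0z , ¬ℙz) = ¬ℙz (ℙᵈ-on-V₀ 1≤n v0z)
      ¬◇*bad : ¬ ⟦ ◇* (var 0 ∧' ¬' ℙ n) ⟧ᵈ V x
      ¬◇*bad ◇*bad = ◇*bad (no-bad x , λ ◇bad → ◇bad (□ᵈ-intro (¬' (var 0 ∧' ¬' ℙ n)) V no-bad x))

  ℂᵈ⇒ℂ*ᵈ : ∀ n V x → ⟦ ℂ n ⟧ᵈ V x → ⟦ ℂ* n ⟧ᵈ V x
  ℂᵈ⇒ℂ*ᵈ n V x ℂx (□*𝔻 , ¬concl*) =
    ℂx (□*𝔻 , λ ¬concl → ¬concl* λ (◇φ₀ , ¬◇*bad) →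
                  ¬concl (◇φ₀ , λ ◇bad → ¬◇*bad λ (_ , ¬◇bad) → ¬◇bad ◇bad))

module Classical (em : ∀ {ℓ : Level} → ExcludedMiddle ℓ) (X : TopSpace) where
  open TopSpace X
  open Space X

  dne : ∀ {A : Set} → ¬ ¬ A → A
  dne = em⇒dne em

  ◇ᶜ⇒closure : ∀ φ V → ⟦ ◇ φ ⟧ᶜ V ⊆ closure X (⟦ φ ⟧ᶜ V)
  ◇ᶜ⇒closure φ V ◇φ c cy = dne λ ¬meet → ◇φ (c , cy , λ z cz φz → ¬meet (z , cz , φz))

  ◇ᵈ⇒derived : ∀ φ V → ⟦ ◇ φ ⟧ᵈ V ⊆ derived X (⟦ φ ⟧ᵈ V)
  ◇ᵈ⇒derived φ V ◇φ c cy = let (z , cz , z≢y , ¬¬φz) = dne ◇φ c cy in z , cz , z≢y , dne ¬¬φz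

  □ᵈ⇒punctured-interior : ∀ φ V → ⟦ □ φ ⟧ᵈ V ⊆ punctured-interior (⟦ φ ⟧ᵈ V)
  □ᵈ⇒punctured-interior φ V □φ = dne λ ¬nbhd → □φ λ c cx →
    dne λ ¬bad → ¬nbhd (c , cx , λ z cz z≢x → dne λ ¬φz → ¬bad (z , cz , z≢x , ¬φz))

  □*ᵈ⇒interior : ∀ φ V → ⟦ □* φ ⟧ᵈ V ⊆ interior X (⟦ φ ⟧ᵈ V)
  □*ᵈ⇒interior φ V {x} (φx , □φ) with □ᵈ⇒punctured-interior φ V □φ
  ... | c , cx , c∖x⊆φ = c , cx , φ-on-c
    where
      φ-on-c : ∀ z → ⟦ c ⟧ z → ⟦ φ ⟧ᵈ V z
      φ-on-c z cz with em {P = z ≡ x}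
      ... | yes refl = φx
      ... | no z≢x   = c∖x⊆φ z cz z≢x

  closure-punctured : ∀ {S x} → derived X S x → closure X S ⊆ closure X (λ z → S z × z ≢ x)
  closure-punctured {S} {x} S′x S̄y c cy with S̄y c cy
  ... | z , cz , sz with em {P = z ≡ x}
  ...   | no z≢x   = z , cz , sz , z≢x
  ...   | yes refl = let (z′ , cz′ , z′≢x , sz′) = S′x c cz in z′ , cz′ , sz′ , z′≢x

  ℙ-fromᶜ⇒closure-step : ∀ {n k} V → k < n →
    ⟦ ℙ-from n k ⟧ᶜ V ⊆ closure X (V (suc k) ∩ ⟦ ℙ-from n (suc k) ⟧ᶜ V)
  ℙ-fromᶜ⇒closure-step {n} {k} V k<n =
    ◇ᶜ⇒closure (var (suc k) ∧' ℙ-from n (suc k)) V ∘ transportᶜ V (ℙ-from-step k<n)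

  ℙ-fromᵈ⇒closure-step : ∀ {n k} V → k < n →
    ⟦ ℙ-from n k ⟧ᵈ V ⊆ closure X (V (suc k) ∩ ⟦ ℙ-from n (suc k) ⟧ᵈ V)
  ℙ-fromᵈ⇒closure-step {n} {k} V k<n =
    derived⊆closure ∘ ◇ᵈ⇒derived (var (suc k) ∧' ℙ-from n (suc k)) V ∘ transportᵈ V (ℙ-from-step k<n)

  ℙ-fromᶜ⇒closure-end : ∀ {n} V → ⟦ ℙ-from n n ⟧ᶜ V ⊆ closure X (V 0)
  ℙ-fromᶜ⇒closure-end {n} V = ◇ᶜ⇒closure (var 0) V ∘ transportᶜ V (ℙ-from-end n)

  ℙ-fromᵈ⇒closure-end : ∀ {n} V → ⟦ ℙ-from n n ⟧ᵈ V ⊆ closure X (V 0)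
  ℙ-fromᵈ⇒closure-end {n} V = derived⊆closure ∘ ◇ᵈ⇒derived (var 0) V ∘ transportᵈ V (ℙ-from-end n)

  HI⇒ℂᶜ : ∀ n → HereditarilyIrresolvable X (suc n) → ∀ V x → ⟦ ℂ n ⟧ᶜ V x
  HI⇒ℂᶜ n hi V x ((_ , u , ux , u⊆𝔻) , ¬concl) =
    ¬concl λ (◇φ₀ , ¬◇bad) → refute ◇φ₀ (dne ¬◇bad)
    where
      refute : ⟦ ◇ var 0 ⟧ᶜ V x → ¬ interior X (⟦ ¬' (var 0 ∧' ¬' ℙ n) ⟧ᶜ V) x
      refute ◇φ₀ (v , vx , v⊆ok) = HI⇒chain-empty hi V w (λ k → ⟦ ℙ-from n k ⟧ᶜ V)
          (λ wy → ⟦𝔻⟧ᶜ-disjoint n (u⊆𝔻 _ (proj₁ (∩ᶜ⁻ wy))))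
          (ℙ-fromᶜ⇒closure-step V)
          (λ (rn , wy) → closure-mono good (closure-∩-open w (ℙ-fromᶜ⇒closure-end {n} V rn , wy)))
          (let (z , wz , v0z) = ◇ᶜ⇒closure (var 0) V ◇φ₀ w (∩ᶜ⁺ (ux , vx)) in z , good (v0z , wz))
        where
          w : Code
          w = u ∩ᶜ v
          good : V 0 ∩ ⟦ w ⟧ ⊆ V 0 ∩ ⟦ w ⟧ ∩ ⟦ ℙ n ⟧ᶜ V
          good (v0z , wz) = v0z , wz , dne λ ¬ℙz → v⊆ok _ (proj₂ (∩ᶜ⁻ wz)) (v0z , ¬ℙz)

  HI⇒ℂᵈ : ∀ n → HereditarilyIrresolvable X (suc n) → ∀ V x → ⟦ ℂ n ⟧ᵈ V x
  HI⇒ℂᵈ n hi V x (□*𝔻 , ¬concl) =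
    ¬concl λ (◇φ₀ , ¬◇bad) → refute (□*ᵈ⇒interior (𝔻 n) V □*𝔻) (◇ᵈ⇒derived (var 0) V ◇φ₀)
                                    (□ᵈ⇒punctured-interior (¬' (var 0 ∧' ¬' ℙ n)) V (dne ¬◇bad))
    where
      refute : interior X (⟦ 𝔻 n ⟧ᵈ V) x → derived X (V 0) x →
               ¬ punctured-interior (⟦ ¬' (var 0 ∧' ¬' ℙ n) ⟧ᵈ V) x
      refute (u , ux , u⊆𝔻) V₀′x (v , vx , v∖x⊆ok) = HI⇒chain-empty hi V w (λ k → ⟦ ℙ-from n k ⟧ᵈ V)
          (λ wy → ⟦𝔻⟧ᵈ-disjoint n (u⊆𝔻 _ (proj₁ (∩ᶜ⁻ wy))))
          (ℙ-fromᵈ⇒closure-step V)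
          (λ (rn , wy) → closure-mono good
             (closure-punctured V₀w′x (closure-∩-open w (ℙ-fromᵈ⇒closure-end {n} V rn , wy))))
          (let (z , _ , z≢x , v0wz) = V₀w′x univ ∈univ in z , good (v0wz , z≢x))
        where
          w : Code
          w = u ∩ᶜ v
          V₀w′x : derived X (V 0 ∩ ⟦ w ⟧) x
          V₀w′x = derived-∩-open w (V₀′x , ∩ᶜ⁺ (ux , vx))
          good : (λ z → (V 0 ∩ ⟦ w ⟧) z × z ≢ x) ⊆ V 0 ∩ ⟦ w ⟧ ∩ ⟦ ℙ n ⟧ᵈ V
          good ((v0z , wz) , z≢x) = v0z , wz , dne λ ¬ℙz → v∖x⊆ok _ (proj₂ (∩ᶜ⁻ wz)) z≢x (v0z , ¬ℙz)

theorem8p4 : (em : ∀ {ℓ : Level} → ExcludedMiddle ℓ) →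
    (n : ℕ) → n ≥ 1 → (X : TopSpace) →
    (_⊨d_ X (ℂ n) ⇔ _⊨d_ X (ℂ* n)) ×
    (_⊨d_ X (ℂ* n) ⇔ _⊨C_ X (ℂ n)) ×
    (_⊨C_ X (ℂ n) ⇔ HereditarilyIrresolvable X (suc n))
theorem8p4 em n n≥1 X =
  mk⇔ d⇒d* (d⇐HI ∘ HI⇐d*) , mk⇔ (C⇐HI ∘ HI⇐d*) (d⇒d* ∘ d⇐HI ∘ HI⇐C) , mk⇔ HI⇐C C⇐HI
  where
    open Space X
    open Classical em X
    open Equivalence

    d⇒d* : _⊨d_ X (ℂ n) → _⊨d_ X (ℂ* n)
    d⇒d* ⊨ℂ = from (⊨d⇔valid (ℂ* n)) λ V x → ℂᵈ⇒ℂ*ᵈ n V x (to (⊨d⇔valid (ℂ n)) ⊨ℂ V x)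

    HI⇐d* : _⊨d_ X (ℂ* n) → HereditarilyIrresolvable X (suc n)
    HI⇐d* = ℂ*ᵈ-valid⇒HI n n≥1 ∘ to (⊨d⇔valid (ℂ* n))

    HI⇐C : _⊨C_ X (ℂ n) → HereditarilyIrresolvable X (suc n)
    HI⇐C = ℂᶜ-valid⇒HI n ∘ to (⊨C⇔valid (ℂ n))

    d⇐HI : HereditarilyIrresolvable X (suc n) → _⊨d_ X (ℂ n)
    d⇐HI = from (⊨d⇔valid (ℂ n)) ∘ HI⇒ℂᵈ n

    C⇐HI : HereditarilyIrresolvable X (suc n) → _⊨C_ X (ℂ n)
    C⇐HI = from (⊨C⇔valid (ℂ n)) ∘ HI⇒ℂᶜ n
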